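{- Let $G$ be an abelian group of order $n$ with a subgroup $H$ of order $m$, and let $k$ be an integer satisfying $$\frac{2nm}{m + 2n} < k < m.$$ Then no subset $C \subseteq H$ of size $k$ is a minimal complement in $G$.
   Context: $C \subseteq G$ is a minimal complement in $G$ if there exists $W \subseteq G$ with $W + C = G$ and $W + C' \neq G$ for every proper subset $C' \subsetneq C$, where $A+B=\{a+b: a\in A, b\in B\}$. -}

module Defs where

open import Data.Nat using (ℕ)
open import Data.Fin using (Fin)
open import Data.Fin.Subset using (Subset; _∈_; _⊆_; _⊂_; ∣_∣)
open import Data.Product using (Σ; ∃; ∃-syntax; _×_)
open import Relation.Binary.PropositionalEquality using (_≡_)
open import Relation.Nullary using (¬_)
open import Algebra.Structures using (IsAbelianGroup)

-- An abelian group of order n, presented (up to isomorphism) on the carrier Fin n.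
record FinAbelianGroup (n : ℕ) : Set where
  field
    _∙_ : Fin n → Fin n → Fin n
    ε : Fin n
    _⁻¹ : Fin n → Fin n
    isAbelianGroup : IsAbelianGroup _≡_ _∙_ ε _⁻¹

module _ {n : ℕ} (G : FinAbelianGroup n) where
  open FinAbelianGroup G

  IsSubgroup : Subset n → Set
  IsSubgroup H = (ε ∈ H)
               × (∀ x y → x ∈ H → y ∈ H → (x ∙ y) ∈ H)
               × (∀ x → x ∈ H → (x ⁻¹) ∈ H)

  SumsetIsWhole : Subset n → Subset n → Set
  SumsetIsWhole W C = ∀ g → ∃[ w ] ∃[ c ] (w ∈ W × c ∈ C × (w ∙ c) ≡ g)

  IsMinimalComplement : Subset n → Set
  IsMinimalComplement C =
    ∃[ W ] (SumsetIsWhole W C × (∀ C′ → C′ ⊂ C → ¬ SumsetIsWhole W C′))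

-- Since W ∙ C = G is minimal, every c ∈ C has a w_c ∈ W such that w_c ∙ c is
-- represented in W ∙ C only through c. Since C ⊆ H, every g lies in a C ⊆ a H for some
-- a ∈ W, and a ∙ h₀ lies in a′ C for some a′ ∈ W; for h₀ ∈ H ∖ C this forces a′ ≠ a, so
-- every coset of H contains two elements of W. For c ∈ C and h ∈ H put
-- g = (w_c ∙ c) ∙ h⁻¹ and pick one of the two elements a ∈ W of the coset g H with
-- a ≠ w_c; then a⁻¹ ∙ w_c ∙ c lies in H ∖ C. The triple (g, a⁻¹ ∙ w_c ∙ c, choice of a)
-- determines (c, h), so k m ≤ 2 n (m − k), i.e. k (m + 2n) ≤ 2 n m.
module Submission where

open import Defs
open import Algebra.Bundles using (Group)
import Algebra.Properties.Group as GroupProperties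
open import Algebra.Structures using (IsAbelianGroup)
open import Data.Bool using (Bool; true; false)
open import Data.Empty using (⊥-elim)
open import Data.Fin using (Fin; zero; suc)
open import Data.Fin.Properties
  using (any?; ¬∀⟶∃¬; _≟_; injective⇒≤; suc-injective; *↔×; 2↔Bool)
open import Data.Fin.Subset using (Subset; inside; outside; _∈_; _∉_; _⊆_; _⊂_; ∣_∣; _─_; _-_)
open import Data.Fin.Subset.Properties
  using (_∈?_; drop-∷-⊆; p⊆q⇒∣p∣≤∣q∣; x∈p⇒p-x⊂p; x∈p∧x≢y⇒x∈p-y; x∈p∧x∉q⇒x∈p─q)
open import Data.Nat using (ℕ; _+_; _*_; _<_; _≤_)
open import Data.Nat.Properties using (+-suc; +-monoˡ-≤; <⇒≱; module ≤-Reasoning)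
open import Data.Nat.Tactic.RingSolver using (solve-∀)
open import Data.Product using (∃₂; ∃-syntax; _×_; _,_; proj₁; proj₂)
open import Data.Product.Function.NonDependent.Propositional using (_×-↔_)
open import Data.Product.Properties using (,-injectiveˡ; ,-injectiveʳ)
open import Data.Vec using ([]; _∷_; here; there)
open import Function using (Injective; _↔_; mk↣; Injection)
open import Function.Construct.Composition using (_↣-∘_; _↔-∘_)
open import Function.Construct.Identity using (↔-id)
open import Function.Construct.Symmetry using (↔-sym)
open import Function.Properties.Inverse using (↔⇒↣)
open import Level using (0ℓ)
open import Relation.Binary.PropositionalEquality
  using (_≡_; _≢_; refl; sym; trans; cong; cong₂; subst; module ≡-Reasoning)
open import Relation.Nullary using (¬_; Dec; yes; no; does)
open import Relation.Nullary.Decidable using (_×-dec_; ¬?)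

element : ∀ {n} (p : Subset n) → Fin ∣ p ∣ → Fin n
element (inside ∷ p) zero = zero
element (inside ∷ p) (suc i) = suc (element p i)
element (outside ∷ p) i = suc (element p i)

element-∈ : ∀ {n} (p : Subset n) (i : Fin ∣ p ∣) → element p i ∈ p
element-∈ (inside ∷ p) zero = here
element-∈ (inside ∷ p) (suc i) = there (element-∈ p i)
element-∈ (outside ∷ p) i = there (element-∈ p i)

element-injective : ∀ {n} (p : Subset n) → Injective _≡_ _≡_ (element p)
element-injective (inside ∷ p) {zero} {zero} _ = refl
element-injective (inside ∷ p) {suc i} {suc j} e = cong suc (element-injective p (suc-injective e))
element-injective (outside ∷ p) e = element-injective p (suc-injective e)

index : ∀ {n} (p : Subset n) {x : Fin n} → x ∈ p → Fin ∣ p ∣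
index (inside ∷ p) here = zero
index (inside ∷ p) (there x∈p) = suc (index p x∈p)
index (outside ∷ p) (there x∈p) = index p x∈p

element-index : ∀ {n} (p : Subset n) {x : Fin n} (x∈p : x ∈ p) → element p (index p x∈p) ≡ x
element-index (inside ∷ p) here = refl
element-index (inside ∷ p) (there x∈p) = cong suc (element-index p x∈p)
element-index (outside ∷ p) (there x∈p) = cong suc (element-index p x∈p)

∣p─q∣+∣q∣≡∣p∣ : ∀ {n} (p q : Subset n) → q ⊆ p → ∣ p ─ q ∣ + ∣ q ∣ ≡ ∣ p ∣
∣p─q∣+∣q∣≡∣p∣ [] [] _ = refl
∣p─q∣+∣q∣≡∣p∣ (inside ∷ p) (inside ∷ q) q⊆p =
  trans (+-suc _ _) (cong ℕ.suc (∣p─q∣+∣q∣≡∣p∣ p q (drop-∷-⊆ q⊆p)))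
∣p─q∣+∣q∣≡∣p∣ (inside ∷ p) (outside ∷ q) q⊆p = cong ℕ.suc (∣p─q∣+∣q∣≡∣p∣ p q (drop-∷-⊆ q⊆p))
∣p─q∣+∣q∣≡∣p∣ (outside ∷ p) (inside ∷ q) q⊆p with () ← q⊆p here
∣p─q∣+∣q∣≡∣p∣ (outside ∷ p) (outside ∷ q) q⊆p = ∣p─q∣+∣q∣≡∣p∣ p q (drop-∷-⊆ q⊆p)

q⊆p∧∣q∣<∣p∣⇒q⊂p : ∀ {n} {p q : Subset n} → q ⊆ p → ∣ q ∣ < ∣ p ∣ → q ⊂ p
q⊆p∧∣q∣<∣p∣⇒q⊂p {p = p} {q} q⊆p ∣q∣<∣p∣ with any? (λ x → (x ∈? p) ×-dec ¬? (x ∈? q))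
... | yes (x , x∈p , x∉q) = q⊆p , x , x∈p , x∉q
... | no ∄x = ⊥-elim (<⇒≱ ∣q∣<∣p∣ (p⊆q⇒∣p∣≤∣q∣ p⊆q))
  where
  p⊆q : p ⊆ _
  p⊆q {x} x∈p with x ∈? q
  ... | yes x∈q = x∈q
  ... | no x∉q = ⊥-elim (∄x (x , x∈p , x∉q))

k[r+k]≤n[r*2]⇒k[r+k+2n]≤2n[r+k] : ∀ n r k → k * (r + k) ≤ n * (r * 2) → k * (r + k + 2 * n) ≤ 2 * n * (r + k)
k[r+k]≤n[r*2]⇒k[r+k+2n]≤2n[r+k] n r k k[r+k]≤n[r*2] = begin
  k * (r + k + 2 * n)       ≡⟨ expand n r k ⟩
  k * (r + k) + 2 * n * k   ≤⟨ +-monoˡ-≤ (2 * n * k) k[r+k]≤n[r*2] ⟩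
  n * (r * 2) + 2 * n * k   ≡⟨ collect n r k ⟩
  2 * n * (r + k)           ∎
  where
  open ≤-Reasoning
  expand : ∀ n r k → k * (r + k + 2 * n) ≡ k * (r + k) + 2 * n * k
  expand = solve-∀
  collect : ∀ n r k → n * (r * 2) + 2 * n * k ≡ 2 * n * (r + k)
  collect = solve-∀

module MinimalComplement {n : ℕ} (G : FinAbelianGroup n) where
  group : Group 0ℓ 0ℓ
  group = record { isGroup = IsAbelianGroup.isGroup (FinAbelianGroup.isAbelianGroup G) }

  open Group group using (_∙_; _⁻¹; _\\_; _//_; assoc)
  open GroupProperties group
    using (\\-leftDividesˡ; //-rightDividesˡ; y≈x\\z; ∙-cancelˡ; ∙-cancelʳ; ⁻¹-anti-homo-∙; ⁻¹-involutive)

  InSumset : Subset n → Subset n → Fin n → Set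
  InSumset W C g = ∃[ w ] ∃[ c ] (w ∈ W × c ∈ C × w ∙ c ≡ g)

  inSumset? : ∀ W C g → Dec (InSumset W C g)
  inSumset? W C g = any? λ w → any? λ c → (w ∈? W) ×-dec (c ∈? C) ×-dec (w ∙ c ≟ g)

  OnlyVia : Subset n → Subset n → Fin n → Fin n → Set
  OnlyVia W C c g = ∀ {w′ c′} → w′ ∈ W → c′ ∈ C → w′ ∙ c′ ≡ g → c′ ≡ c

  ∉W∙[C-c]⇒onlyVia : ∀ {W C c g} → ¬ InSumset W (C - c) g → OnlyVia W C c g
  ∉W∙[C-c]⇒onlyVia {c = c} g∉W∙[C-c] {w′} {c′} w′∈W c′∈C w′∙c′≡g with c′ ≟ c
  ... | yes c′≡c = c′≡c
  ... | no c′≢c = ⊥-elim (g∉W∙[C-c] (w′ , c′ , w′∈W , x∈p∧x≢y⇒x∈p-y c′∈C c′≢c , w′∙c′≡g))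

  minimal⇒onlyVia : ∀ {W C} → SumsetIsWhole G W C → (∀ C′ → C′ ⊂ C → ¬ SumsetIsWhole G W C′) →
                    ∀ {c} → c ∈ C → ∃[ w ] (w ∈ W × OnlyVia W C c (w ∙ c))
  minimal⇒onlyVia {W} {C} cover minimal {c} c∈C
    with g , g∉W∙[C-c] ← ¬∀⟶∃¬ n _ (inSumset? W (C - c)) (minimal (C - c) (x∈p⇒p-x⊂p c∈C))
    with w , c′ , w∈W , c′∈C , w∙c′≡g ← cover g
    with refl ← ∉W∙[C-c]⇒onlyVia g∉W∙[C-c] w∈W c′∈C w∙c′≡g
    = w , w∈W , λ w′∈W c″∈C w′∙c″≡w∙c → ∉W∙[C-c]⇒onlyVia g∉W∙[C-c] w′∈W c″∈C (trans w′∙c″≡w∙c w∙c′≡g)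

  module Cosets {H : Subset n} (H-subgroup : IsSubgroup G H) where
    ∙-closed : ∀ {x y} → x ∈ H → y ∈ H → x ∙ y ∈ H
    ∙-closed = proj₁ (proj₂ H-subgroup) _ _

    ⁻¹-closed : ∀ {x} → x ∈ H → x ⁻¹ ∈ H
    ⁻¹-closed = proj₂ (proj₂ H-subgroup) _

    infix 4 _∼_
    _∼_ : Fin n → Fin n → Set
    x ∼ y = x \\ y ∈ H

    ∼-by : ∀ {x y z} → y ∈ H → x ∙ y ≡ z → x ∼ z
    ∼-by {x} {y} y∈H x∙y≡z = subst (_∈ H) (y≈x\\z x y _ x∙y≡z) y∈H

    ∼-sym : ∀ {x y} → x ∼ y → y ∼ x
    ∼-sym {x} {y} x∼y = subst (_∈ H) [x\\y]⁻¹≡y\\x (⁻¹-closed x∼y)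
      where
      open ≡-Reasoning
      [x\\y]⁻¹≡y\\x : (x \\ y) ⁻¹ ≡ y \\ x
      [x\\y]⁻¹≡y\\x = begin
        (x ⁻¹ ∙ y) ⁻¹      ≡⟨ ⁻¹-anti-homo-∙ (x ⁻¹) y ⟩
        y ⁻¹ ∙ x ⁻¹ ⁻¹     ≡⟨ cong (y ⁻¹ ∙_) (⁻¹-involutive x) ⟩
        y ⁻¹ ∙ x           ∎

    ∼-trans : ∀ {x y z} → x ∼ y → y ∼ z → x ∼ z
    ∼-trans {x} {y} {z} x∼y y∼z = subst (_∈ H) [x\\y]∙[y\\z]≡x\\z (∙-closed x∼y y∼z)
      where
      open ≡-Reasoning
      [x\\y]∙[y\\z]≡x\\z : (x \\ y) ∙ (y \\ z) ≡ x \\ z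
      [x\\y]∙[y\\z]≡x\\z = begin
        (x ⁻¹ ∙ y) ∙ (y \\ z)   ≡⟨ assoc (x ⁻¹) y (y \\ z) ⟩
        x ⁻¹ ∙ (y ∙ (y \\ z))   ≡⟨ cong (x ⁻¹ ∙_) (\\-leftDividesˡ y z) ⟩
        x ⁻¹ ∙ z                ∎

    two-in-every-coset : ∀ {W C} → SumsetIsWhole G W C → C ⊆ H → ∀ {h₀} → h₀ ∈ H → h₀ ∉ C →
                         ∀ g → ∃₂ λ a a′ → (a ∈ W × a ∼ g) × (a′ ∈ W × a′ ∼ g) × a ≢ a′
    two-in-every-coset {W} {C} cover C⊆H {h₀} h₀∈H h₀∉C g
      with a , c , a∈W , c∈C , a∙c≡g ← cover g
      with a′ , c′ , a′∈W , c′∈C , a′∙c′≡a∙h₀ ← cover (a ∙ h₀)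
      = a , a′ , (a∈W , a∼g) , (a′∈W , a′∼g) , a≢a′
      where
      a∼g : a ∼ g
      a∼g = ∼-by (C⊆H c∈C) a∙c≡g
      a′∼g : a′ ∼ g
      a′∼g = ∼-trans (∼-trans (∼-by (C⊆H c′∈C) a′∙c′≡a∙h₀) (∼-sym (∼-by h₀∈H refl))) a∼g
      a≢a′ : a ≢ a′
      a≢a′ refl = h₀∉C (subst (_∈ C) (∙-cancelˡ a c′ h₀ a′∙c′≡a∙h₀) c′∈C)

  module Counting {H W C : Subset n} (H-subgroup : IsSubgroup G H) (C⊆H : C ⊆ H)
                  (cover : SumsetIsWhole G W C) (minimal : ∀ C′ → C′ ⊂ C → ¬ SumsetIsWhole G W C′)
                  {h₀ : Fin n} (h₀∈H : h₀ ∈ H) (h₀∉C : h₀ ∉ C) where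
    open Cosets H-subgroup

    private
      two : ∀ g → ∃₂ λ a a′ → (a ∈ W × a ∼ g) × (a′ ∈ W × a′ ∼ g) × a ≢ a′
      two = two-in-every-coset cover C⊆H h₀∈H h₀∉C

    pick : Fin n → Bool → Fin n
    pick g false = proj₁ (two g)
    pick g true = proj₁ (proj₂ (two g))

    pick-∈ : ∀ g b → pick g b ∈ W × pick g b ∼ g
    pick-∈ g false = proj₁ (proj₂ (proj₂ (two g)))
    pick-∈ g true = proj₁ (proj₂ (proj₂ (proj₂ (two g))))

    avoiding : Fin n → Fin n → Bool
    avoiding g w = does (w ≟ pick g false)

    pick-avoiding : ∀ g w → pick g (avoiding g w) ≢ w
    pick-avoiding g w with w ≟ pick g false
    ... | yes w≡a = λ a′≡w → proj₂ (proj₂ (proj₂ (proj₂ (two g)))) (trans (sym w≡a) (sym a′≡w))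
    ... | no w≢a = λ a≡w → w≢a (sym a≡w)

    module Code {c h : Fin n} (c∈C : c ∈ C) (h∈H : h ∈ H) where
      w : Fin n
      w = proj₁ (minimal⇒onlyVia cover minimal c∈C)

      w∈W : w ∈ W
      w∈W = proj₁ (proj₂ (minimal⇒onlyVia cover minimal c∈C))

      onlyVia : OnlyVia W C c (w ∙ c)
      onlyVia = proj₂ (proj₂ (minimal⇒onlyVia cover minimal c∈C))

      target shift : Fin n
      target = w ∙ c
      shift = target // h

      bit : Bool
      bit = avoiding shift w

      a d : Fin n
      a = pick shift bit
      d = a \\ target

      a∙d≡target : a ∙ d ≡ target
      a∙d≡target = \\-leftDividesˡ a target

      d∈H─C : d ∈ H ─ C
      d∈H─C = x∈p∧x∉q⇒x∈p─q d∈H d∉C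
        where
        d∈H : d ∈ H
        d∈H = ∼-trans (proj₂ (pick-∈ shift bit)) (∼-by h∈H (//-rightDividesˡ h target))
        d∉C : d ∉ C
        d∉C d∈C = pick-avoiding shift w (∙-cancelʳ c a w
          (subst (λ x → a ∙ x ≡ target) (onlyVia (proj₁ (pick-∈ shift bit)) d∈C a∙d≡target) a∙d≡target))

    code : ∀ {c h} → c ∈ C → h ∈ H → Fin n × Fin n × Bool
    code c∈C h∈H = shift , d , bit
      where open Code c∈C h∈H

    code-injective : ∀ {c h c′ h′} (c∈C : c ∈ C) (h∈H : h ∈ H) (c′∈C : c′ ∈ C) (h′∈H : h′ ∈ H) →
                     code c∈C h∈H ≡ code c′∈C h′∈H → c ≡ c′ × h ≡ h′
    code-injective {c} {h} {c′} {h′} c∈C h∈H c′∈C h′∈H eq = c≡c′ , h≡h′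
      where
      module X = Code c∈C h∈H
      module Y = Code c′∈C h′∈H
      open ≡-Reasoning
      shift≡ : X.shift ≡ Y.shift
      shift≡ = ,-injectiveˡ eq
      d≡ : X.d ≡ Y.d
      d≡ = ,-injectiveˡ (,-injectiveʳ eq)
      bit≡ : X.bit ≡ Y.bit
      bit≡ = ,-injectiveʳ (,-injectiveʳ eq)
      target≡ : X.target ≡ Y.target
      target≡ = begin
        X.target   ≡⟨ sym X.a∙d≡target ⟩
        X.a ∙ X.d  ≡⟨ cong₂ _∙_ (cong₂ pick shift≡ bit≡) d≡ ⟩
        Y.a ∙ Y.d  ≡⟨ Y.a∙d≡target ⟩
        Y.target   ∎
      c≡c′ : c ≡ c′
      c≡c′ = sym (X.onlyVia Y.w∈W c′∈C (sym target≡))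
      h≡h′ : h ≡ h′
      h≡h′ = ∙-cancelˡ Y.shift h h′ (begin
        Y.shift ∙ h    ≡⟨ cong (_∙ h) shift≡ ⟨
        X.shift ∙ h    ≡⟨ //-rightDividesˡ h X.target ⟩
        X.target       ≡⟨ target≡ ⟩
        Y.target       ≡⟨ //-rightDividesˡ h′ Y.target ⟨
        Y.shift ∙ h′   ∎)

    encode : Fin ∣ C ∣ × Fin ∣ H ∣ → Fin n × Fin ∣ H ─ C ∣ × Bool
    encode (i , j) = shift , index (H ─ C) d∈H─C , bit
      where open Code (element-∈ C i) (element-∈ H j)

    encode-injective : Injective _≡_ _≡_ encode
    encode-injective {i , j} {i′ , j′} eq =
      cong₂ _,_ (element-injective C (proj₁ element≡)) (element-injective H (proj₂ element≡))
      where
      module X = Code (element-∈ C i) (element-∈ H j)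
      module Y = Code (element-∈ C i′) (element-∈ H j′)
      d≡ : X.d ≡ Y.d
      d≡ = begin
        X.d                                               ≡⟨ element-index (H ─ C) X.d∈H─C ⟨
        element (H ─ C) (index (H ─ C) X.d∈H─C)           ≡⟨ cong (element (H ─ C)) (,-injectiveˡ (,-injectiveʳ eq)) ⟩
        element (H ─ C) (index (H ─ C) Y.d∈H─C)           ≡⟨ element-index (H ─ C) Y.d∈H─C ⟩
        Y.d                                               ∎
        where open ≡-Reasoning
      code≡ : code (element-∈ C i) (element-∈ H j) ≡ code (element-∈ C i′) (element-∈ H j′)
      code≡ = cong₂ _,_ (,-injectiveˡ eq) (cong₂ _,_ d≡ (,-injectiveʳ (,-injectiveʳ eq)))
      element≡ : element C i ≡ element C i′ × element H j ≡ element H j′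
      element≡ = code-injective (element-∈ C i) (element-∈ H j) (element-∈ C i′) (element-∈ H j′) code≡

    ∣C∣*∣H∣≤n*[∣H─C∣*2] : ∣ C ∣ * ∣ H ∣ ≤ n * (∣ H ─ C ∣ * 2)
    ∣C∣*∣H∣≤n*[∣H─C∣*2] = injective⇒≤ (Injection.injective
      (↔⇒↣ (↔-sym codomain) ↣-∘ (mk↣ encode-injective ↣-∘ ↔⇒↣ *↔×)))
      where
      codomain : Fin (n * (∣ H ─ C ∣ * 2)) ↔ (Fin n × Fin ∣ H ─ C ∣ × Bool)
      codomain = (↔-id _ ×-↔ ((↔-id _ ×-↔ 2↔Bool) ↔-∘ *↔×)) ↔-∘ *↔×

proposition4p1 : (n : ℕ) (G : FinAbelianGroup n) (H : Subset n) (m k : ℕ)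
    → IsSubgroup G H → ∣ H ∣ ≡ m
    → 2 * n * m < k * (m + 2 * n) → k < m
    → (C : Subset n) → C ⊆ H → ∣ C ∣ ≡ k
    → ¬ IsMinimalComplement G C
proposition4p1 n G H m k H-subgroup refl 2nm<k[m+2n] k<m C C⊆H refl (W , cover , minimal)
  with _ , h₀ , h₀∈H , h₀∉C ← q⊆p∧∣q∣<∣p∣⇒q⊂p C⊆H k<m
  = <⇒≱ 2nm<k[m+2n] (subst (λ m → k * (m + 2 * n) ≤ 2 * n * m) ∣H─C∣+∣C∣≡∣H∣
      (k[r+k]≤n[r*2]⇒k[r+k+2n]≤2n[r+k] n ∣ H ─ C ∣ k
        (subst (λ m → k * m ≤ n * (∣ H ─ C ∣ * 2)) (sym ∣H─C∣+∣C∣≡∣H∣) ∣C∣*∣H∣≤n*[∣H─C∣*2])))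
  where
  open MinimalComplement G
  open Counting H-subgroup C⊆H cover minimal h₀∈H h₀∉C
  ∣H─C∣+∣C∣≡∣H∣ : ∣ H ─ C ∣ + ∣ C ∣ ≡ ∣ H ∣
  ∣H─C∣+∣C∣≡∣H∣ = ∣p─q∣+∣q∣≡∣p∣ H C C⊆H
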